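{- Suppose $\gcd(m,n) = 1$, $m \geq 3$ and $n \geq 3$. Then $\mathsf{DL}^{\circ}(L_{m,n}) \geq \frac{m+n}{2} - 1$ if $m,n$ are both odd, and $\mathsf{DL}^{\circ}(L_{m,n}) \geq \frac{m+n-3}{2}$ if $m+n$ is odd.
   Context: $L_{m,n}$ is the $m\times n$ grid graph, i.e. the Cartesian product of a path on $m$ vertices and a path on $n$ vertices. For a finite connected graph $G=(V,E)$ with $|V|=N$ and graph distance $d$, a $k$-circular-dispersed labelling is a bijection $\phi:\mathbb{Z}_N\to V$ with $d(\phi(i),\phi(i+1))\ge k$ for all $i\in\mathbb{Z}_N$; $\mathsf{DL}^\circ(G)$ is the maximum such $k$. -}

module Defs where

open import Data.Nat using (ℕ; zero; suc; _+_; _*_; _≤_; _<_; NonZero)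
open import Data.Nat.DivMod using (_%_; m%n<n)
open import Data.Fin using (Fin; toℕ; fromℕ<)
open import Data.Product using (_×_; _,_; Σ)
open import Function.Bundles using (_⤖_; Bijection)
open import Relation.Binary.PropositionalEquality using (_≡_)
open import Data.Sum using (_⊎_)
open import Data.Empty using (⊥)

Vertex : ℕ → ℕ → Set
Vertex m n = Fin m × Fin n

PathAdj : {m : ℕ} → Fin m → Fin m → Set
PathAdj i j = (suc (toℕ i) ≡ toℕ j) ⊎ (suc (toℕ j) ≡ toℕ i)

GridAdj : {m n : ℕ} → Vertex m n → Vertex m n → Set
GridAdj (i , j) (i' , j') = (PathAdj i i' × j ≡ j') ⊎ (i ≡ i' × PathAdj j j')

data Walk {m n : ℕ} : Vertex m n → Vertex m n → ℕ → Set where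
  here : ∀ {u} → Walk u u zero
  step : ∀ {u v w ℓ} → GridAdj u v → Walk v w ℓ → Walk u w (suc ℓ)

DistAtLeast : {m n : ℕ} → ℕ → Vertex m n → Vertex m n → Set
DistAtLeast k u v = ∀ ℓ → ℓ < k → Walk u v ℓ → ⊥

-- Successor in Z_N.
-- (i + 1) mod N; the argument i witnesses N = suc N'.
sucMod : (N : ℕ) → Fin N → Fin N
sucMod (suc N) i = fromℕ< (m%n<n (suc (toℕ i)) (suc N))

CircDispersed : (m n : ℕ) → ℕ → Set
CircDispersed m n k =
  Σ (Fin (m * n) ⤖ Vertex m n) λ φ →
    ∀ (i : Fin (m * n)) →
      DistAtLeast k (Bijection.to φ i) (Bijection.to φ (sucMod (m * n) i))

-- Label t ∈ ℤ_{mn} by (z_p (t mod m) , z_q (t mod n)), where z_p is the zigzag order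
-- 0, p+1, 1, p+2, 2, … of a path on m ∈ {2p+1, 2p+2} vertices.  Cyclically consecutive
-- entries of z_p are at least p apart, so consecutive labels are at Manhattan distance,
-- and hence graph distance, at least p + q; since gcd(m,n) = 1 the labelling is a
-- bijection by the Chinese remainder theorem.  With p = ⌊(m-1)/2⌋ and q = ⌊(n-1)/2⌋,
-- p + q is at least the bound claimed in both cases (the parity hypothesis of the second
-- case is not even needed, and 3 ≤ m, n is only used as m, n ≥ 1).
module Submission where

open import Defs
open import Algebra.Properties.CommutativeSemigroup using (interchange)
open import Data.Fin using (Fin; toℕ; fromℕ<; combine; punchOut)
open import Data.Fin.Properties
  using (toℕ-fromℕ<; toℕ-injective; toℕ<n; combine-injective; any?; _≟_; punchOut-injective; injective⇒≤)
open import Data.Nat using (ℕ; zero; suc; _+_; _*_; _∸_; _≤_; _<_; z≤n; s≤s; s≤s⁻¹; NonZero; >-nonZero; ∣_-_∣; _/_; _%_)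
open import Data.Nat.DivMod
  using (m%n<n; m≡m%n+[m/n]*n; %-distribˡ-+; m%n%n≡m%n; m<n⇒m%n≡m; n%n≡0; %-congˡ; m∣n⇒o%n%m≡o%m; m*n%n≡0; m<n*o⇒m/o<n)
open import Data.Nat.Divisibility using (_∣_; divides; >⇒∤; m∣m*n; n∣m*n)
open import Data.Nat.GCD using (gcd)
open import Data.Nat.LCM using (lcm; lcm-least; gcd*lcm)
open import Data.Nat.Properties hiding (_≟_)
open import Data.Nat.Tactic.RingSolver using (solve-∀)
open import Data.Product using (_×_; _,_; ∃; uncurry)
open import Data.Product.Properties using (,-injectiveˡ; ,-injectiveʳ)
open import Data.Sum using (inj₁; inj₂)
open import Function.Base using (_∘′_)
open import Function.Bundles using (mk⤖)
open import Function.Consequences.Propositional using (strictlySurjective⇒surjective)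
open import Function.Definitions using (Injective; Bijective; StrictlySurjective)
open import Relation.Binary.PropositionalEquality
open import Relation.Nullary using (yes; no; contradiction)

data Parity : ℕ → Set where
  even : ∀ h → Parity (h + h)
  odd  : ∀ h → Parity (suc (h + h))

parity : ∀ s → Parity s
parity zero = even zero
parity (suc s) with parity s
... | even h = odd h
... | odd h = subst Parity (cong suc (+-suc h h)) (even (suc h))

half-≤ : ∀ {h p} → h + h < 2 + (p + p) → h ≤ p
half-≤ {h} {p} lt = ≮⇒≥ λ p<h →
  <⇒≱ lt (subst (_≤ h + h) (cong suc (+-suc p p)) (+-mono-≤ p<h p<h))

half-≥ : ∀ {h p} → p + p ≤ h + h → p ≤ h
half-≥ le = ≮⇒≥ λ h<p → <⇒≱ (+-mono-< h<p h<p) le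

suc-% : ∀ t d .{{_ : NonZero d}} → suc t % d ≡ suc (t % d) % d
suc-% t d = begin
  (1 + t) % d             ≡⟨ %-distribˡ-+ 1 t d ⟩
  (1 % d + t % d) % d     ≡⟨ cong (λ r → (1 % d + r) % d) (m%n%n≡m%n t d) ⟨
  (1 % d + t % d % d) % d ≡⟨ %-distribˡ-+ 1 (t % d) d ⟨
  (1 + t % d) % d         ∎
  where open ≡-Reasoning

%≡%⇒∣∸ : ∀ d .{{_ : NonZero d}} {x y} → x ≤ y → x % d ≡ y % d → d ∣ y ∸ x
%≡%⇒∣∸ d {x} {y} x≤y x≡y = divides (y / d ∸ x / d) (begin
  y ∸ x                                     ≡⟨ cong₂ _∸_ (m≡m%n+[m/n]*n y d) (m≡m%n+[m/n]*n x d) ⟩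
  (y % d + y / d * d) ∸ (x % d + x / d * d) ≡⟨ cong (λ r → (y % d + y / d * d) ∸ (r + x / d * d)) x≡y ⟩
  (y % d + y / d * d) ∸ (y % d + x / d * d) ≡⟨ [m+n]∸[m+o]≡n∸o (y % d) _ _ ⟩
  y / d * d ∸ x / d * d                     ≡⟨ *-distribʳ-∸ d (y / d) (x / d) ⟨
  (y / d ∸ x / d) * d                       ∎)
  where open ≡-Reasoning

coprime⇒*∣ : ∀ {m n k} → gcd m n ≡ 1 → m ∣ k → n ∣ k → m * n ∣ k
coprime⇒*∣ {m} {n} gcd≡1 m∣k n∣k = subst (_∣ _) lcm≡m*n (lcm-least m∣k n∣k)
  where
  open ≡-Reasoning
  lcm≡m*n : lcm m n ≡ m * n
  lcm≡m*n = begin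
    lcm m n           ≡⟨ *-identityˡ (lcm m n) ⟨
    1 * lcm m n       ≡⟨ cong (_* lcm m n) gcd≡1 ⟨
    gcd m n * lcm m n ≡⟨ gcd*lcm m n ⟩
    m * n             ∎

chinese-remainder-injective-≤ : ∀ {m n x y} .{{_ : NonZero m}} .{{_ : NonZero n}} → gcd m n ≡ 1 →
  x ≤ y → y < m * n → x % m ≡ y % m → x % n ≡ y % n → x ≡ y
chinese-remainder-injective-≤ {m} {n} {x} {y} gcd≡1 x≤y y<mn x≡y[m] x≡y[n] with y ∸ x in y∸x≡
... | zero = ≤-antisym x≤y (m∸n≡0⇒m≤n y∸x≡)
... | suc d = contradiction mn∣y∸x (>⇒∤ (≤-<-trans (subst (_≤ y) y∸x≡ (m∸n≤m y x)) y<mn))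
  where
  mn∣y∸x : m * n ∣ suc d
  mn∣y∸x = subst (m * n ∣_) y∸x≡ (coprime⇒*∣ gcd≡1 (%≡%⇒∣∸ m x≤y x≡y[m]) (%≡%⇒∣∸ n x≤y x≡y[n]))

chinese-remainder-injective : ∀ {m n x y} .{{_ : NonZero m}} .{{_ : NonZero n}} → gcd m n ≡ 1 →
  x < m * n → y < m * n → x % m ≡ y % m → x % n ≡ y % n → x ≡ y
chinese-remainder-injective {x = x} {y} gcd≡1 x<mn y<mn x≡y[m] x≡y[n] with ≤-total x y
... | inj₁ x≤y = chinese-remainder-injective-≤ gcd≡1 x≤y y<mn x≡y[m] x≡y[n]
... | inj₂ y≤x = sym (chinese-remainder-injective-≤ gcd≡1 y≤x x<mn (sym x≡y[m]) (sym x≡y[n]))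

injective⇒strictlySurjective : ∀ {n} {f : Fin n → Fin n} → Injective _≡_ _≡_ f → StrictlySurjective _≡_ f
injective⇒strictlySurjective {suc n} {f} f-inj y with any? (λ x → f x ≟ y)
... | yes hit = hit
... | no miss = contradiction (injective⇒≤ squeeze-injective) 1+n≰n
  where
  avoids : ∀ x → y ≢ f x
  avoids x y≡fx = miss (x , sym y≡fx)
  squeeze : Fin (suc n) → Fin n
  squeeze x = punchOut (avoids x)
  squeeze-injective : Injective _≡_ _≡_ squeeze
  squeeze-injective eq = f-inj (punchOut-injective (avoids _) (avoids _) eq)

injective⇒bijective-× : ∀ {m n} {f : Fin (m * n) → Fin m × Fin n} → Injective _≡_ _≡_ f → Bijective _≡_ _≡_ f
injective⇒bijective-× {m} {n} {f} f-inj = f-inj , strictlySurjective⇒surjective hit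
  where
  uncurry-combine-injective : Injective _≡_ _≡_ (uncurry (combine {m} {n}))
  uncurry-combine-injective {i , j} {k , l} eq with refl , refl ← combine-injective i j k l eq = refl
  hit : StrictlySurjective _≡_ f
  hit y with t , eq ← injective⇒strictlySurjective (f-inj ∘′ uncurry-combine-injective) (uncurry combine y) =
    t , uncurry-combine-injective eq

manhattan : ∀ {m n} → Vertex m n → Vertex m n → ℕ
manhattan (i , j) (i' , j') = ∣ toℕ i - toℕ i' ∣ + ∣ toℕ j - toℕ j' ∣

manhattan-triangle : ∀ {m n} (u v w : Vertex m n) → manhattan u w ≤ manhattan u v + manhattan v w
manhattan-triangle (i , j) (i' , j') (i'' , j'') = ≤-trans
  (+-mono-≤ (∣-∣-triangle (toℕ i) (toℕ i') (toℕ i'')) (∣-∣-triangle (toℕ j) (toℕ j') (toℕ j'')))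
  (≤-reflexive (interchange +-commutativeSemigroup
    ∣ toℕ i - toℕ i' ∣ ∣ toℕ i' - toℕ i'' ∣ ∣ toℕ j - toℕ j' ∣ ∣ toℕ j' - toℕ j'' ∣))

pathAdj⇒∣-∣≡1 : ∀ {m} {i j : Fin m} → PathAdj i j → ∣ toℕ i - toℕ j ∣ ≡ 1
pathAdj⇒∣-∣≡1 {i = i} (inj₁ eq) rewrite sym eq = trans (m≤n⇒∣m-n∣≡n∸m (n≤1+n (toℕ i))) (m+n∸n≡m 1 (toℕ i))
pathAdj⇒∣-∣≡1 {j = j} (inj₂ eq) rewrite sym eq = trans (m≤n⇒∣n-m∣≡n∸m (n≤1+n (toℕ j))) (m+n∸n≡m 1 (toℕ j))

gridAdj⇒manhattan≡1 : ∀ {m n} {u v : Vertex m n} → GridAdj u v → manhattan u v ≡ 1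
gridAdj⇒manhattan≡1 {u = _ , j} (inj₁ (adj , refl)) = cong₂ _+_ (pathAdj⇒∣-∣≡1 adj) (∣n-n∣≡0 (toℕ j))
gridAdj⇒manhattan≡1 {u = i , _} (inj₂ (refl , adj)) = cong₂ _+_ (∣n-n∣≡0 (toℕ i)) (pathAdj⇒∣-∣≡1 adj)

walk⇒manhattan≤length : ∀ {m n} {u v : Vertex m n} {ℓ} → Walk u v ℓ → manhattan u v ≤ ℓ
walk⇒manhattan≤length {u = i , j} here = ≤-reflexive (cong₂ _+_ (∣n-n∣≡0 (toℕ i)) (∣n-n∣≡0 (toℕ j)))
walk⇒manhattan≤length {u = u} (step {v = v} {w = w} adj walk) = ≤-trans (manhattan-triangle u v w)
  (+-mono-≤ (≤-reflexive (gridAdj⇒manhattan≡1 adj)) (walk⇒manhattan≤length walk))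

manhattan⇒distAtLeast : ∀ {m n k} {u v : Vertex m n} → k ≤ manhattan u v → DistAtLeast k u v
manhattan⇒distAtLeast k≤d ℓ ℓ<k walk = <⇒≱ ℓ<k (≤-trans k≤d (walk⇒manhattan≤length walk))

zigzag : ℕ → ℕ → ℕ
zigzag p zero = zero
zigzag p (suc zero) = suc p
zigzag p (suc (suc s)) = suc (zigzag p s)

zigzag-even : ∀ p h → zigzag p (h + h) ≡ h
zigzag-even p zero = refl
zigzag-even p (suc h) rewrite +-suc h h = cong suc (zigzag-even p h)

zigzag-odd : ∀ p h → zigzag p (suc (h + h)) ≡ suc (h + p)
zigzag-odd p zero = refl
zigzag-odd p (suc h) rewrite +-suc h h = cong suc (zigzag-odd p h)

zigzag-step : ∀ p s → p ≤ ∣ zigzag p s - zigzag p (suc s) ∣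
zigzag-step p s with parity s
... | even h rewrite zigzag-even p h | zigzag-odd p h | sym (+-suc h p) | ∣m-m+n∣≡n h (suc p) = n≤1+n p
... | odd h rewrite zigzag-odd p h | zigzag-even p h =
  ≤-reflexive (sym (trans (∣-∣-comm (h + p) h) (∣m-m+n∣≡n h p)))

module ZigzagOnPath (p m : ℕ) (2p<m : p + p < m) (m≤2+2p : m ≤ 2 + (p + p)) where

  instance
    nonZero : NonZero m
    nonZero = >-nonZero (≤-trans (s≤s z≤n) 2p<m)

  zigzag-< : ∀ s → s < m → zigzag p s < m
  zigzag-< s s<m with parity s
  zigzag-< _ s<m | even h rewrite zigzag-even p h = ≤-trans (s≤s (m≤m+n h h)) s<m
  zigzag-< _ s<m | odd h rewrite zigzag-odd p h with h <? p
  ... | yes h<p = ≤-trans (s≤s (+-monoˡ-≤ p h<p)) 2p<m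
  ... | no h≮p = ≤-trans (s≤s (s≤s (+-monoʳ-≤ h (≮⇒≥ h≮p)))) s<m

  -- Positions 2h carry the values h ≤ p, positions 2h+1 the values h+p+1 > p.
  zigzag-injective : ∀ {s s'} → s < m → s' < m → zigzag p s ≡ zigzag p s' → s ≡ s'
  zigzag-injective {s} {s'} s<m s'<m eq with parity s | parity s'
  ... | even h | even h' rewrite zigzag-even p h | zigzag-even p h' = cong (λ x → x + x) eq
  ... | odd h | odd h' rewrite zigzag-odd p h | zigzag-odd p h' =
    cong (λ x → suc (x + x)) (+-cancelʳ-≡ p h h' (suc-injective eq))
  ... | even h | odd h' rewrite zigzag-even p h | zigzag-odd p h' =
    contradiction (subst (_≤ p) eq (half-≤ (≤-trans s<m m≤2+2p))) (<⇒≱ (s≤s (m≤n+m p h')))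
  ... | odd h | even h' rewrite zigzag-odd p h | zigzag-even p h' =
    contradiction (subst (_≤ p) (sym eq) (half-≤ (≤-trans s'<m m≤2+2p))) (<⇒≱ (s≤s (m≤n+m p h)))

  zigzag-wrap : ∀ s → suc s ≡ m → p ≤ zigzag p s
  zigzag-wrap s 1+s≡m with parity s
  ... | even h rewrite zigzag-even p h = half-≥ (s≤s⁻¹ (subst (suc (p + p) ≤_) (sym 1+s≡m) 2p<m))
  ... | odd h rewrite zigzag-odd p h = ≤-trans (m≤n+m p h) (n≤1+n _)

  zigzag-cyclic-step : ∀ s → s < m → p ≤ ∣ zigzag p s - zigzag p (suc s % m) ∣
  zigzag-cyclic-step s s<m with m≤n⇒m<n∨m≡n s<m
  ... | inj₁ 1+s<m rewrite m<n⇒m%n≡m 1+s<m = zigzag-step p s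
  ... | inj₂ 1+s≡m rewrite trans (%-congˡ 1+s≡m) (n%n≡0 m) | ∣-∣-identityʳ (zigzag p s) = zigzag-wrap s 1+s≡m

  position : ℕ → Fin m
  position t = fromℕ< (zigzag-< (t % m) (m%n<n t m))

  toℕ-position : ∀ t → toℕ (position t) ≡ zigzag p (t % m)
  toℕ-position t = toℕ-fromℕ< _

  position-injective : ∀ {t t'} → position t ≡ position t' → t % m ≡ t' % m
  position-injective {t} {t'} eq = zigzag-injective (m%n<n t m) (m%n<n t' m)
    (trans (sym (toℕ-position t)) (trans (cong toℕ eq) (toℕ-position t')))

  position-cong : ∀ {t t'} → t % m ≡ t' % m → position t ≡ position t'
  position-cong {t} {t'} eq = toℕ-injective
    (trans (toℕ-position t) (trans (cong (zigzag p) eq) (sym (toℕ-position t'))))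

  position-step : ∀ t → p ≤ ∣ toℕ (position t) - toℕ (position (suc t)) ∣
  position-step t = subst (p ≤_) (sym (cong₂ ∣_-_∣ (toℕ-position t) (trans (toℕ-position (suc t))
    (cong (zigzag p) (suc-% t m))))) (zigzag-cyclic-step (t % m) (m%n<n t m))

toℕ-sucMod : ∀ N .{{_ : NonZero N}} (t : Fin N) → toℕ (sucMod N t) ≡ suc (toℕ t) % N
toℕ-sucMod (suc N) t = toℕ-fromℕ< _

toℕ-sucMod-% : ∀ {N} d .{{_ : NonZero d}} .{{_ : NonZero N}} → d ∣ N →
  ∀ t → toℕ (sucMod N t) % d ≡ suc (toℕ t) % d
toℕ-sucMod-% {N} d d∣N t = trans (%-congˡ (toℕ-sucMod N t)) (m∣n⇒o%n%m≡o%m d N (suc (toℕ t)) d∣N)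

module ZigzagLabelling {m n : ℕ} (p q : ℕ) (gcd≡1 : gcd m n ≡ 1)
  (2p<m : p + p < m) (m≤2+2p : m ≤ 2 + (p + p)) (2q<n : q + q < n) (n≤2+2q : n ≤ 2 + (q + q)) where

  module Row = ZigzagOnPath p m 2p<m m≤2+2p
  module Col = ZigzagOnPath q n 2q<n n≤2+2q

  instance
    m≢0 : NonZero m
    m≢0 = Row.nonZero
    n≢0 : NonZero n
    n≢0 = Col.nonZero
    mn≢0 : NonZero (m * n)
    mn≢0 = m*n≢0 m n

  label : Fin (m * n) → Vertex m n
  label t = Row.position (toℕ t) , Col.position (toℕ t)

  label-injective : Injective _≡_ _≡_ label
  label-injective {t} {t'} eq = toℕ-injective (chinese-remainder-injective gcd≡1 (toℕ<n t) (toℕ<n t')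
    (Row.position-injective (,-injectiveˡ eq)) (Col.position-injective (,-injectiveʳ eq)))

  label-sucMod : ∀ t → label (sucMod (m * n) t) ≡ (Row.position (suc (toℕ t)) , Col.position (suc (toℕ t)))
  label-sucMod t = cong₂ _,_ (Row.position-cong (toℕ-sucMod-% m (m∣m*n n) t))
                             (Col.position-cong (toℕ-sucMod-% n (n∣m*n m) t))

  label-step : ∀ t → p + q ≤ manhattan (label t) (label (sucMod (m * n) t))
  label-step t = subst (λ v → p + q ≤ manhattan (label t) v) (sym (label-sucMod t))
    (+-mono-≤ (Row.position-step (toℕ t)) (Col.position-step (toℕ t)))

  zigzag-circDispersed : CircDispersed m n (p + q)
  zigzag-circDispersed = mk⤖ (injective⇒bijective-× label-injective) , λ t → manhattan⇒distAtLeast (label-step t)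

open ZigzagLabelling using (zigzag-circDispersed)

circDispersed-antimono : ∀ {m n k k'} → k ≤ k' → CircDispersed m n k' → CircDispersed m n k
circDispersed-antimono k≤k' (φ , dispersed) = φ , λ t ℓ ℓ<k → dispersed t ℓ (≤-trans ℓ<k k≤k')

n+n≡n*2 : ∀ n → n + n ≡ n * 2
n+n≡n*2 n = trans (cong (n +_) (sym (+-identityʳ n))) (*-comm 2 n)

/2-≤ : ∀ {x k} → x ≤ suc (k + k) → x / 2 ≤ k
/2-≤ {x} {k} x≤ = s≤s⁻¹ (m<n*o⇒m/o<n (s≤s (subst (λ z → x ≤ suc z) (n+n≡n*2 k) x≤)))

∃2p<m≤2+2p : ∀ {m} → 0 < m → ∃ λ p → p + p < m × m ≤ 2 + (p + p)
∃2p<m≤2+2p {suc m} _ with parity m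
... | even p = p , ≤-refl , n≤1+n _
... | odd p = p , n≤1+n _ , ≤-refl

odd-≤ : ∀ {m p} → m % 2 ≡ 1 → m ≤ 2 + (p + p) → m ≤ suc (p + p)
odd-≤ {m} {p} m-odd m≤2+2p with m≤n⇒m<n∨m≡n m≤2+2p
... | inj₁ m<2+2p = s≤s⁻¹ m<2+2p
... | inj₂ refl = contradiction (trans (sym m-odd) 2+2p-even) λ ()
  where
  2+2p-even : (2 + (p + p)) % 2 ≡ 0
  2+2p-even = trans (cong (λ x → (2 + x) % 2) (n+n≡n*2 p)) (m*n%n≡0 (suc p) 2)

odd-bound : ∀ {m n} p q → m % 2 ≡ 1 → n % 2 ≡ 1 → m ≤ 2 + (p + p) → n ≤ 2 + (q + q) →
  (m + n) / 2 ∸ 1 ≤ p + q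
odd-bound {m} {n} p q m-odd n-odd m≤ n≤ = ∸-monoˡ-≤ 1 (/2-≤ {k = suc (p + q)} (begin
  m + n                            ≤⟨ +-mono-≤ (odd-≤ {p = p} m-odd m≤) (odd-≤ {p = q} n-odd n≤) ⟩
  suc (p + p) + suc (q + q)        ≡⟨ shuffle p q ⟩
  suc (p + q) + suc (p + q)        ≤⟨ n≤1+n _ ⟩
  suc (suc (p + q) + suc (p + q))  ∎))
  where
  open ≤-Reasoning
  shuffle : ∀ p q → suc (p + p) + suc (q + q) ≡ suc (p + q) + suc (p + q)
  shuffle = solve-∀

mixed-bound : ∀ {m n} p q → m ≤ 2 + (p + p) → n ≤ 2 + (q + q) → (m + n ∸ 3) / 2 ≤ p + q
mixed-bound {m} {n} p q m≤ n≤ = /2-≤ {k = p + q} (begin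
  m + n ∸ 3                                ≤⟨ ∸-monoˡ-≤ 3 (+-mono-≤ m≤ n≤)  ⟩
  (2 + (p + p)) + (2 + (q + q)) ∸ 3        ≡⟨ cong (_∸ 3) (shuffle p q) ⟩
  3 + suc ((p + q) + (p + q)) ∸ 3          ≡⟨ m+n∸m≡n 3 _ ⟩
  suc ((p + q) + (p + q))                  ∎)
  where
  open ≤-Reasoning
  shuffle : ∀ p q → (2 + (p + p)) + (2 + (q + q)) ≡ 3 + suc ((p + q) + (p + q))
  shuffle = solve-∀

theorem3p4 : (m n : ℕ) → gcd m n ≡ 1 → 3 ≤ m → 3 ≤ n →
    ((m % 2 ≡ 1 × n % 2 ≡ 1) → CircDispersed m n ((m + n) / 2 ∸ 1)) ×
    ((m + n) % 2 ≡ 1 → CircDispersed m n ((m + n ∸ 3) / 2))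
theorem3p4 m n gcd≡1 3≤m 3≤n with ∃2p<m≤2+2p (≤-trans (s≤s z≤n) 3≤m) | ∃2p<m≤2+2p (≤-trans (s≤s z≤n) 3≤n)
... | p , 2p<m , m≤2+2p | q , 2q<n , n≤2+2q =
    (λ (m-odd , n-odd) → circDispersed-antimono (odd-bound p q m-odd n-odd m≤2+2p n≤2+2q) dispersed)
  , (λ _ → circDispersed-antimono (mixed-bound p q m≤2+2p n≤2+2q) dispersed)
  where
  dispersed : CircDispersed m n (p + q)
  dispersed = zigzag-circDispersed p q gcd≡1 2p<m m≤2+2p 2q<n n≤2+2q
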